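{- Let $n\ge 2$, $\pi\in S_n(132)$ and $\sigma=\psi(\pi)$, where $\psi$ is defined below. Writing $\tau^{ -1}_k$ for the position of the value $k$ in a permutation $\tau$: (1) $\pi^{ -1}_n=1$ if and only if $\sigma^{ -1}_n=1$; (2) $2\le\pi^{ -1}_n\le n-1$ if and only if $\sigma^{ -1}_n>1$ and $\sigma^{ -1}_n-\sigma^{ -1}_{n-1}>1$; (3) $\pi^{ -1}_n=n$ if and only if $\sigma^{ -1}_n>1$ and $\sigma^{ -1}_n-\sigma^{ -1}_{n-1}=1$.
   Context: $S_n$ is the set of permutations of $\{1,\dots,n\}$ in one-line notation; $S_n(132)$ those avoiding the classical pattern $132$. For permutations $\alpha$ (length $a$), $\beta$ (length $b$): $\alpha\oplus\beta$ has entries $\alpha_i$ ($i\le a$) and $\beta_{i-a}+a$ ($i>a$); $\alpha\ominus\beta$ has entries $\alpha_i+b$ ($i\le a$) and $\beta_{i-a}$ ($i>a$); $1$ is the length-one permutation. A nonempty $132$-avoiding permutation can be written uniquely as $(\alpha\oplus1)\ominus\beta$ and also uniquely as $\alpha\ominus(\beta\oplus1)$, with $\alpha,\beta$ possibly empty $132$-avoiding permutations. The map $\psi$ on nonempty $132$-avoiding permutations is defined recursively (its values are again $132$-avoiding, so the decompositions used exist): $\psi(1)=1$; for $\pi\in S_n(132)$, $n\ge2$: (i) if $\pi=1\ominus\alpha$, then $\psi(\pi)=1\ominus\psi(\alpha)$; (ii) if $\pi=(\alpha\oplus1)\ominus\beta$ with $\alpha,\beta$ both nonempty, write $\psi(\beta)=\gamma\ominus(\delta\oplus1)$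 and set $\psi(\pi)=((\psi(\alpha)\ominus(\delta\oplus1))\oplus1)\ominus\gamma$; (iii) if $\pi=\alpha\oplus1$ with $\alpha$ nonempty, write $\psi(\alpha)=(\gamma\oplus1)\ominus\delta$ and set $\psi(\pi)=((\gamma\oplus1)\oplus1)\ominus\delta$. -}

module Defs where

open import Data.Nat using (ℕ; zero; suc; _+_; _∸_; _≡ᵇ_)
open import Data.Bool using (if_then_else_)
open import Data.List using (List; []; _∷_; _++_; map; length; take; drop; upTo)
open import Data.List.Base using (lookup)
open import Data.Product using (_×_; _,_)
open import Data.Fin using (Fin; _<_)
import Data.Nat as ℕ
open import Relation.Nullary using (¬_)
open import Data.List.Relation.Binary.Permutation.Propositional using (_↭_)

-- Permutations are lists of naturals in one-line notation (values 1..n).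

IsPerm : ℕ → List ℕ → Set
IsPerm n π = π ↭ map suc (upTo n)

Avoids132 : List ℕ → Set
Avoids132 π = (i j k : Fin (length π)) → i < j → j < k →
  ¬ ((lookup π i ℕ.< lookup π k) × (lookup π k ℕ.< lookup π j))

_⊕_ : List ℕ → List ℕ → List ℕ
α ⊕ β = α ++ map (_+ length α) β

_⊖_ : List ℕ → List ℕ → List ℕ
α ⊖ β = map (_+ length β) α ++ β

one : List ℕ
one = 1 ∷ []

splitAtVal : ℕ → List ℕ → List ℕ × List ℕ
splitAtVal m [] = [] , []
splitAtVal m (x ∷ xs) with x ≡ᵇ m
... | Data.Bool.true = [] , xs
... | Data.Bool.false with splitAtVal m xs
...   | L , R = x ∷ L , R

-- unique decomposition π = (α ⊕ 1) ⊖ β   (returns (α , β))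
decompA : List ℕ → List ℕ × List ℕ
decompA π with splitAtVal (length π) π
... | L , R = map (_∸ length R) L , R

lastElem : List ℕ → ℕ
lastElem [] = 0
lastElem (x ∷ []) = x
lastElem (x ∷ y ∷ ys) = lastElem (y ∷ ys)

initL : List ℕ → List ℕ
initL [] = []
initL (x ∷ []) = []
initL (x ∷ y ∷ ys) = x ∷ initL (y ∷ ys)

-- unique decomposition π = γ ⊖ (δ ⊕ 1)   (returns (γ , δ))
decompB : List ℕ → List ℕ × List ℕ
decompB π = map (_∸ m) (take (length π ∸ m) π) , initL (drop (length π ∸ m) π)
  where m = lastElem π

-- ψ, computed with fuel (fuel = length of the input suffices, since all
-- recursive calls are on strictly shorter permutations)
ψ′ : ℕ → List ℕ → List ℕ
ψ′ zero _ = []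
ψ′ (suc k) [] = []
ψ′ (suc k) π@(_ ∷ _) with splitAtVal (length π) π
-- (i) π = 1 ⊖ α   (this also covers ψ(1) = 1, with α empty)
... | [] , R = one ⊖ ψ′ k R
-- (iii) π = α ⊕ 1, α nonempty
... | L@(_ ∷ _) , [] with decompA (ψ′ k L)
...   | γ , δ = ((γ ⊕ one) ⊕ one) ⊖ δ
-- (ii) π = (α ⊕ 1) ⊖ β, α, β nonempty
ψ′ (suc k) π@(_ ∷ _) | L@(_ ∷ _) , R@(_ ∷ _) with decompB (ψ′ k R)
...   | γ , δ = ((ψ′ k (map (_∸ length R) L) ⊖ (δ ⊕ one)) ⊕ one) ⊖ γ

ψ : List ℕ → List ℕ
ψ π = ψ′ (length π) π

-- τ⁻¹_k : the (1-based) position of the value k in τ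
pos : ℕ → List ℕ → ℕ
pos k [] = 0
pos k (x ∷ xs) = if x ≡ᵇ k then 1 else suc (pos k xs)

module Submission where

-- A nonempty 132-avoiding permutation π of [1..n] is uniquely
-- (α ⊕ 1) ⊖ β, so π⁻¹(n) = |α| + 1, and ψ(π) is computed from ψ(α), ψ(β) by
-- the rule (i), (ii) or (iii) that applies.  Each rule outputs a
-- permutation of the same shape (X ⊕ 1) ⊖ Y, so σ⁻¹(n) = |X| + 1 as well:
--   (i)   α = ∅:           X = ∅, so σ⁻¹(n) = 1;
--   (iii) β = ∅:           X = γ ⊕ 1, so n-1 stands directly before n;
--   (ii)  α, β ≠ ∅:        X = ψ(α) ⊖ (δ ⊕ 1) and n-1 lies in the ψ(α) block,
--                          at least |δ ⊕ 1| + 1 ≥ 2 places before n.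
-- Since these are exactly the cases π⁻¹(n) = 1, = n, and in between, the
-- three equivalences follow.

open import Defs
open import Data.Nat using (ℕ; zero; suc; _+_; _∸_; _≤_; _<_; z≤n; s≤s; s≤s⁻¹; _≡ᵇ_)
open import Data.Nat.Properties
open import Data.Nat.Induction using (<-wellFounded)
open import Data.Bool using (true; false)
open import Data.Fin using (Fin; toℕ) renaming (zero to fzero; suc to fsuc)
open import Data.List using (List; []; _∷_; _++_; _∷ʳ_; map; length; take; drop; upTo)
open import Data.List.Base using (lookup)
open import Data.List.Properties
  using (map-++; length-++; length-map; ++-assoc; ++-identityʳ; map-cong; map-id; map-∘; map-id-local;
         upTo-∷ʳ; length-upTo; ∷-injective)
open import Data.List.Relation.Unary.All as All using (All; []; _∷_)
import Data.List.Relation.Unary.All.Properties as All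
open import Data.List.Relation.Unary.Any using (here; there)
open import Data.List.Membership.Propositional using (_∈_)
open import Data.List.Membership.Propositional.Properties using (∈-map⁺; ∈-map⁻; ∈-++⁺ˡ; ∈-++⁺ʳ; ∈-++⁻; ∈-∃++)
open import Data.List.Relation.Binary.Permutation.Propositional
  using (_↭_; ↭-refl; ↭-sym; ↭-trans; ↭-reflexive; module PermutationReasoning)
open import Data.List.Relation.Binary.Permutation.Propositional.Properties
  using (∈-resp-↭; ↭-length; drop-mid; shift; ∷↭∷ʳ; ++⁺ʳ) renaming (map⁺ to ↭-map⁺)
open import Data.Product using (_×_; _,_; Σ-syntax; ∃-syntax; proj₁; proj₂)
open import Data.Sum using (inj₁; inj₂)
open import Data.Empty using (⊥-elim)
open import Function using (_∘_)
open import Function.Bundles using (_⇔_; mk⇔)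
open import Induction.WellFounded using (Acc; acc)
open import Relation.Nullary using (¬_; yes; no)
open import Relation.Binary.PropositionalEquality

-- (α ⊕ 1) ⊖ β in explicit form: the maximum |α|+|β|+1 sits between the
-- block α (lifted above β) and β.  Every nonempty 132-avoider has this shape.
join : List ℕ → List ℕ → List ℕ
join α β = map (_+ length β) α ++ suc (length α + length β) ∷ β

join-sums : ∀ α β → (α ⊕ one) ⊖ β ≡ join α β
join-sums α β = trans (cong (_++ β) (map-++ (_+ length β) α (suc (length α) ∷ [])))
                      (++-assoc (map (_+ length β) α) _ β)

length-join : ∀ α β → length (join α β) ≡ suc (length α + length β)
length-join α β = begin
  length (map (_+ length β) α ++ _ ∷ β)  ≡⟨ length-++ (map (_+ length β) α) ⟩
  length (map (_+ length β) α) + suc (length β) ≡⟨ cong (_+ suc (length β)) (length-map _ α) ⟩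
  length α + suc (length β)              ≡⟨ +-suc (length α) (length β) ⟩
  suc (length α + length β)              ∎
  where open ≡-Reasoning

length-⊖ : ∀ α β → length (α ⊖ β) ≡ length α + length β
length-⊖ α β = trans (length-++ (map (_+ length β) α)) (cong (_+ length β) (length-map _ α))

length-⊕ : ∀ α β → length (α ⊕ β) ≡ length α + length β
length-⊕ α β = trans (length-++ α) (cong (length α +_) (length-map _ β))

length-⊕one : ∀ α → length (α ⊕ one) ≡ suc (length α)
length-⊕one α = trans (length-⊕ α one) (+-comm (length α) 1)

join≢[] : ∀ α β → join α β ≢ []
join≢[] [] β ()
join≢[] (_ ∷ α) β ()

map-+0 : ∀ xs → map (_+ 0) xs ≡ xs
map-+0 xs = trans (map-cong +-identityʳ xs) (map-id xs)

map-+-+ : ∀ a b xs → map (_+ b) (map (_+ a) xs) ≡ map (_+ (a + b)) xs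
map-+-+ a b xs = trans (sym (map-∘ xs)) (map-cong (λ x → +-assoc x a b) xs)

map-+-∸ : ∀ c xs → map (_∸ c) (map (_+ c) xs) ≡ xs
map-+-∸ c xs = trans (sym (map-∘ xs)) (trans (map-cong (λ x → m+n∸n≡m x c) xs) (map-id xs))

⊖-identityʳ : ∀ α → α ⊖ [] ≡ α
⊖-identityʳ α = trans (++-identityʳ _) (map-+0 α)

⊖-assoc : ∀ α β γ → (α ⊖ β) ⊖ γ ≡ α ⊖ (β ⊖ γ)
⊖-assoc α β γ = begin
  map (_+ length γ) (map (_+ length β) α ++ β) ++ γ
    ≡⟨ cong (_++ γ) (map-++ (_+ length γ) (map (_+ length β) α) β) ⟩
  (map (_+ length γ) (map (_+ length β) α) ++ map (_+ length γ) β) ++ γ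
    ≡⟨ ++-assoc (map (_+ length γ) (map (_+ length β) α)) _ γ ⟩
  map (_+ length γ) (map (_+ length β) α) ++ (map (_+ length γ) β ++ γ)
    ≡⟨ cong (_++ (map (_+ length γ) β ++ γ)) (map-+-+ (length β) (length γ) α) ⟩
  map (_+ (length β + length γ)) α ++ (β ⊖ γ)
    ≡⟨ cong (λ m → map (_+ m) α ++ (β ⊖ γ)) (sym (length-⊖ β γ)) ⟩
  α ⊖ (β ⊖ γ) ∎
  where open ≡-Reasoning

-- The class of 132-avoiding permutations, described inductively by the
-- decomposition (α ⊕ 1) ⊖ β.  Av132-complete below shows that it contains
-- every 132-avoiding permutation of [1..n].
data Av132 : List ℕ → Set where
  empty : Av132 []
  node  : ∀ {α β} → Av132 α → Av132 β → Av132 (join α β)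

Av132-⊕one : ∀ {α} → Av132 α → Av132 (α ⊕ one)
Av132-⊕one {α} cα = subst Av132 (trans (sym (join-sums α [])) (⊖-identityʳ (α ⊕ one))) (node cα empty)

Av132-⊖ : ∀ {α β} → Av132 α → Av132 β → Av132 (α ⊖ β)
Av132-⊖ empty cβ = cβ
Av132-⊖ {β = β} (node {α₁} {α₂} cα₁ cα₂) cβ = subst Av132 eq (node cα₁ (Av132-⊖ cα₂ cβ))
  where
  eq : join α₁ (α₂ ⊖ β) ≡ join α₁ α₂ ⊖ β
  eq = begin
    join α₁ (α₂ ⊖ β)          ≡⟨ sym (join-sums α₁ (α₂ ⊖ β)) ⟩
    (α₁ ⊕ one) ⊖ (α₂ ⊖ β)     ≡⟨ sym (⊖-assoc (α₁ ⊕ one) α₂ β) ⟩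
    ((α₁ ⊕ one) ⊖ α₂) ⊖ β     ≡⟨ cong (_⊖ β) (join-sums α₁ α₂) ⟩
    join α₁ α₂ ⊖ β            ∎
    where open ≡-Reasoning

Av132-bounded : ∀ {p} → Av132 p → All (_≤ length p) p
Av132-bounded empty = []
Av132-bounded (node {α} {β} cα cβ) rewrite length-join α β =
  All.++⁺ (All.map⁺ (All.map (λ x≤ → ≤-trans (+-monoˡ-≤ (length β) x≤) (n≤1+n _)) (Av132-bounded cα)))
          (≤-refl ∷ All.map (λ x≤ → ≤-trans x≤ (≤-trans (m≤n+m _ (length α)) (n≤1+n _))) (Av132-bounded cβ))

Av132-lifted-below : ∀ {q} c k → Av132 q → length q + c < k → All (_< k) (map (_+ c) q)
Av132-lifted-below c k cq lt = All.map⁺ (All.map (λ x≤ → ≤-trans (s≤s (+-monoˡ-≤ c x≤)) lt) (Av132-bounded cq))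

Av132-max∈ : ∀ {q} → Av132 q → q ≢ [] → length q ∈ q
Av132-max∈ empty ne = ⊥-elim (ne refl)
Av132-max∈ (node {α} {β} cα cβ) _ rewrite length-join α β = ∈-++⁺ʳ (map (_+ length β) α) (here refl)

Av132-join : ∀ {q} → Av132 q → q ≢ [] → ∃[ γ ] ∃[ δ ] Av132 γ × Av132 δ × q ≡ join γ δ
Av132-join empty ne = ⊥-elim (ne refl)
Av132-join (node cγ cδ) _ = _ , _ , cγ , cδ , refl

-- Second decomposition: every nonempty member is γ ⊖ (δ ⊕ 1); the δ ⊕ 1
-- block is found by descending along the right spine.
Av132-end : ∀ {q} → Av132 q → q ≢ [] → ∃[ γ ] ∃[ δ ] Av132 γ × Av132 δ × q ≡ γ ⊖ (δ ⊕ one)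
Av132-end empty ne = ⊥-elim (ne refl)
Av132-end (node {α} cα empty) _ = [] , α , empty , cα , trans (sym (join-sums α [])) (⊖-identityʳ _)
Av132-end (node {α} {β} cα cβ@(node _ _)) _ with Av132-end cβ (join≢[] _ _)
... | γ , δ , cγ , cδ , eq = (α ⊕ one) ⊖ γ , δ , Av132-⊖ (Av132-⊕one cα) cγ , cδ , (begin
  join α β                        ≡⟨ sym (join-sums α β) ⟩
  (α ⊕ one) ⊖ β                   ≡⟨ cong ((α ⊕ one) ⊖_) eq ⟩
  (α ⊕ one) ⊖ (γ ⊖ (δ ⊕ one))     ≡⟨ sym (⊖-assoc (α ⊕ one) γ (δ ⊕ one)) ⟩
  ((α ⊕ one) ⊖ γ) ⊖ (δ ⊕ one)     ∎)
  where open ≡-Reasoning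

≡ᵇ-refl : ∀ n → (n ≡ᵇ n) ≡ true
≡ᵇ-refl zero = refl
≡ᵇ-refl (suc n) = ≡ᵇ-refl n

<⇒≡ᵇ-false : ∀ {m n} → m < n → (m ≡ᵇ n) ≡ false
<⇒≡ᵇ-false {zero} {suc n} _ = refl
<⇒≡ᵇ-false {suc m} {suc n} (s≤s m<n) = <⇒≡ᵇ-false m<n

splitAtVal-at : ∀ k xs R → All (_< k) xs → splitAtVal k (xs ++ k ∷ R) ≡ (xs , R)
splitAtVal-at k [] R [] rewrite ≡ᵇ-refl k = refl
splitAtVal-at k (x ∷ xs) R (x<k ∷ xs<k) rewrite <⇒≡ᵇ-false x<k | splitAtVal-at k xs R xs<k = refl

pos-at : ∀ k xs ys → All (_< k) xs → pos k (xs ++ k ∷ ys) ≡ suc (length xs)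
pos-at k [] ys [] rewrite ≡ᵇ-refl k = refl
pos-at k (x ∷ xs) ys (x<k ∷ xs<k) rewrite <⇒≡ᵇ-false x<k = cong suc (pos-at k xs ys xs<k)

pos-within : ∀ k xs ys → k ∈ xs → pos k (xs ++ ys) ≤ length xs
pos-within k (x ∷ xs) ys (here refl) rewrite ≡ᵇ-refl x = s≤s z≤n
pos-within k (x ∷ xs) ys (there k∈xs) with x ≡ᵇ k
... | true = s≤s z≤n
... | false = s≤s (pos-within k xs ys k∈xs)

splitAtVal-join : ∀ {α} β → Av132 α →
  splitAtVal (suc (length α + length β)) (join α β) ≡ (map (_+ length β) α , β)
splitAtVal-join β cα = splitAtVal-at _ _ β (Av132-lifted-below (length β) _ cα ≤-refl)

pos-join : ∀ {α} β → Av132 α → pos (suc (length α + length β)) (join α β) ≡ suc (length α)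
pos-join {α} β cα =
  trans (pos-at _ _ β (Av132-lifted-below (length β) _ cα ≤-refl)) (cong suc (length-map _ α))

decompA-join : ∀ {γ} δ → Av132 γ → decompA (join γ δ) ≡ (γ , δ)
decompA-join {γ} δ cγ rewrite length-join γ δ | splitAtVal-join δ cγ =
  cong (_, δ) (map-+-∸ (length δ) γ)

lastElem-∷ʳ : ∀ xs y → lastElem (xs ∷ʳ y) ≡ y
lastElem-∷ʳ [] y = refl
lastElem-∷ʳ (x ∷ []) y = refl
lastElem-∷ʳ (x ∷ x′ ∷ xs) y = lastElem-∷ʳ (x′ ∷ xs) y

initL-∷ʳ : ∀ xs y → initL (xs ∷ʳ y) ≡ xs
initL-∷ʳ [] y = refl
initL-∷ʳ (x ∷ []) y = refl
initL-∷ʳ (x ∷ x′ ∷ xs) y = cong (x ∷_) (initL-∷ʳ (x′ ∷ xs) y)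

take-length-++ : ∀ (xs ys : List ℕ) → take (length xs) (xs ++ ys) ≡ xs
take-length-++ [] [] = refl
take-length-++ [] (_ ∷ _) = refl
take-length-++ (x ∷ xs) ys = cong (x ∷_) (take-length-++ xs ys)

drop-length-++ : ∀ (xs ys : List ℕ) → drop (length xs) (xs ++ ys) ≡ ys
drop-length-++ [] ys = refl
drop-length-++ (x ∷ xs) ys = drop-length-++ xs ys

-- decompB recovers (γ , δ) from γ ⊖ (δ ⊕ 1): the last entry |δ|+1 tells
-- how many entries the trailing block has.
decompB-end : ∀ γ δ → decompB (γ ⊖ (δ ⊕ one)) ≡ (γ , δ)
decompB-end γ δ = evaluate
  where
  s = length (δ ⊕ one)
  s≡ : s ≡ suc (length δ)
  s≡ = length-⊕one δ
  last≡ : lastElem (γ ⊖ (δ ⊕ one)) ≡ suc (length δ)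
  last≡ = trans (cong lastElem (sym (++-assoc (map (_+ s) γ) δ _))) (lastElem-∷ʳ (map (_+ s) γ ++ δ) _)
  cut≡ : length (γ ⊖ (δ ⊕ one)) ∸ suc (length δ) ≡ length (map (_+ s) γ)
  cut≡ = begin
    length (γ ⊖ (δ ⊕ one)) ∸ suc (length δ)  ≡⟨ cong (_∸ suc (length δ)) (length-⊖ γ (δ ⊕ one)) ⟩
    length γ + s ∸ suc (length δ)             ≡⟨ cong (λ m → length γ + m ∸ suc (length δ)) s≡ ⟩
    length γ + suc (length δ) ∸ suc (length δ) ≡⟨ m+n∸n≡m (length γ) (suc (length δ)) ⟩
    length γ                                  ≡⟨ sym (length-map _ γ) ⟩
    length (map (_+ s) γ)                     ∎
    where open ≡-Reasoning
  evaluate : decompB (γ ⊖ (δ ⊕ one)) ≡ (γ , δ)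
  evaluate rewrite last≡ | cut≡ | take-length-++ (map (_+ s) γ) (δ ⊕ one)
                 | drop-length-++ (map (_+ s) γ) (δ ⊕ one) | initL-∷ʳ δ (suc (length δ)) =
    cong (_, δ) (trans (cong (λ m → map (_∸ suc (length δ)) (map (_+ m) γ)) s≡) (map-+-∸ _ γ))

rule-iii : List ℕ × List ℕ → List ℕ
rule-iii (γ , δ) = ((γ ⊕ one) ⊕ one) ⊖ δ

rule-ii : List ℕ → List ℕ × List ℕ → List ℕ
rule-ii ψα (γ , δ) = ((ψα ⊖ (δ ⊕ one)) ⊕ one) ⊖ γ

combine : List ℕ → List ℕ → List ℕ → List ℕ → List ℕ
combine []      _       _  ψβ = one ⊖ ψβ
combine (_ ∷ _) []      ψα _  = rule-iii (decompA ψα)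
combine (_ ∷ _) (_ ∷ _) ψα ψβ = rule-ii ψα (decompB ψβ)

combine-iii : ∀ α ψα ψβ → α ≢ [] → combine α [] ψα ψβ ≡ rule-iii (decompA ψα)
combine-iii [] _ _ ne = ⊥-elim (ne refl)
combine-iii (_ ∷ _) _ _ _ = refl

combine-ii : ∀ α β ψα ψβ → α ≢ [] → β ≢ [] → combine α β ψα ψβ ≡ rule-ii ψα (decompB ψβ)
combine-ii [] _ _ _ ne _ = ⊥-elim (ne refl)
combine-ii (_ ∷ _) [] _ _ _ ne = ⊥-elim (ne refl)
combine-ii (_ ∷ _) (_ ∷ _) _ _ _ _ = refl

ψ-step : ℕ → List ℕ × List ℕ → List ℕ
ψ-step k ([] , R) = one ⊖ ψ′ k R
ψ-step k (L@(_ ∷ _) , []) = rule-iii (decompA (ψ′ k L))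
ψ-step k (L@(_ ∷ _) , R@(_ ∷ _)) = rule-ii (ψ′ k (map (_∸ length R) L)) (decompB (ψ′ k R))

ψ′-unfold : ∀ k π → π ≢ [] → ψ′ (suc k) π ≡ ψ-step k (splitAtVal (length π) π)
ψ′-unfold k [] ne = ⊥-elim (ne refl)
ψ′-unfold k (x ∷ xs) _ with splitAtVal (length (x ∷ xs)) (x ∷ xs)
... | [] , R = refl
... | L@(_ ∷ _) , [] with decompA (ψ′ k L)
...   | _ = refl
ψ′-unfold k (x ∷ xs) _ | L@(_ ∷ _) , R@(_ ∷ _) with decompB (ψ′ k R)
...   | _ = refl

ψ-step-join : ∀ k α β → ψ-step k (map (_+ length β) α , β) ≡ combine α β (ψ′ k α) (ψ′ k β)
ψ-step-join k [] β = refl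
ψ-step-join k α@(_ ∷ _) [] = cong (λ L → rule-iii (decompA (ψ′ k L))) (map-+0 α)
ψ-step-join k α@(_ ∷ _) β@(_ ∷ _) =
  cong (λ L → rule-ii (ψ′ k L) (decompB (ψ′ k β))) (map-+-∸ (length β) α)

ψ′-join : ∀ k {α} β → Av132 α → ψ′ (suc k) (join α β) ≡ combine α β (ψ′ k α) (ψ′ k β)
ψ′-join k {α} β cα = begin
  ψ′ (suc k) (join α β)                                   ≡⟨ ψ′-unfold k (join α β) (join≢[] α β) ⟩
  ψ-step k (splitAtVal (length (join α β)) (join α β))     ≡⟨ cong (λ m → ψ-step k (splitAtVal m (join α β))) (length-join α β) ⟩
  ψ-step k (splitAtVal (suc (length α + length β)) (join α β)) ≡⟨ cong (ψ-step k) (splitAtVal-join β cα) ⟩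
  ψ-step k (map (_+ length β) α , β)                       ≡⟨ ψ-step-join k α β ⟩
  combine α β (ψ′ k α) (ψ′ k β)                            ∎
  where open ≡-Reasoning

ψ′-fuel : ∀ {p} → Av132 p → ∀ k → length p ≤ k → ψ′ k p ≡ ψ p
ψ′-fuel empty zero _ = refl
ψ′-fuel empty (suc k) _ = refl
ψ′-fuel (node {α} {β} cα cβ) zero le with ≤-trans (≤-reflexive (sym (length-join α β))) le
... | ()
ψ′-fuel (node {α} {β} cα cβ) (suc k) le = begin
  ψ′ (suc k) (join α β)           ≡⟨ ψ′-join k β cα ⟩
  combine α β (ψ′ k α) (ψ′ k β)   ≡⟨ cong₂ (combine α β) (ψ′-fuel cα k α≤k) (ψ′-fuel cβ k β≤k) ⟩
  combine α β (ψ α) (ψ β)         ≡⟨ sym (cong₂ (combine α β) (ψ′-fuel cα K (m≤m+n _ _)) (ψ′-fuel cβ K (m≤n+m _ _))) ⟩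
  combine α β (ψ′ K α) (ψ′ K β)   ≡⟨ sym (ψ′-join K β cα) ⟩
  ψ′ (suc K) (join α β)           ≡⟨ cong (λ m → ψ′ m (join α β)) (sym (length-join α β)) ⟩
  ψ (join α β)                    ∎
  where
  open ≡-Reasoning
  K = length α + length β
  K≤k : K ≤ k
  K≤k = s≤s⁻¹ (≤-trans (≤-reflexive (sym (length-join α β))) le)
  α≤k = ≤-trans (m≤m+n _ _) K≤k
  β≤k = ≤-trans (m≤n+m _ _) K≤k

ψ-join : ∀ {α β} → Av132 α → Av132 β → ψ (join α β) ≡ combine α β (ψ α) (ψ β)
ψ-join {α} {β} cα cβ = begin
  ψ (join α β)                    ≡⟨ cong (λ m → ψ′ m (join α β)) (length-join α β) ⟩
  ψ′ (suc K) (join α β)           ≡⟨ ψ′-join K β cα ⟩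
  combine α β (ψ′ K α) (ψ′ K β)   ≡⟨ cong₂ (combine α β) (ψ′-fuel cα K (m≤m+n _ _)) (ψ′-fuel cβ K (m≤n+m _ _)) ⟩
  combine α β (ψ α) (ψ β)         ∎
  where
  open ≡-Reasoning
  K = length α + length β

ψ-case-i : ∀ {β} → Av132 β → ψ (join [] β) ≡ join [] (ψ β)
ψ-case-i cβ = ψ-join empty cβ

ψ-case-iii : ∀ {α γ δ} → Av132 α → α ≢ [] → Av132 γ → ψ α ≡ join γ δ →
  ψ (join α []) ≡ join (γ ⊕ one) δ
ψ-case-iii {α} {γ} {δ} cα ne cγ ψα≡ = begin
  ψ (join α [])                        ≡⟨ ψ-join cα empty ⟩
  combine α [] (ψ α) []                ≡⟨ combine-iii α (ψ α) [] ne ⟩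
  rule-iii (decompA (ψ α))             ≡⟨ cong (rule-iii ∘ decompA) ψα≡ ⟩
  rule-iii (decompA (join γ δ))        ≡⟨ cong rule-iii (decompA-join δ cγ) ⟩
  ((γ ⊕ one) ⊕ one) ⊖ δ                ≡⟨ join-sums (γ ⊕ one) δ ⟩
  join (γ ⊕ one) δ                     ∎
  where open ≡-Reasoning

ψ-case-ii : ∀ {α β γ δ} → Av132 α → α ≢ [] → Av132 β → β ≢ [] → ψ β ≡ γ ⊖ (δ ⊕ one) →
  ψ (join α β) ≡ join (ψ α ⊖ (δ ⊕ one)) γ
ψ-case-ii {α} {β} {γ} {δ} cα neα cβ neβ ψβ≡ = begin
  ψ (join α β)                           ≡⟨ ψ-join cα cβ ⟩
  combine α β (ψ α) (ψ β)                ≡⟨ combine-ii α β (ψ α) (ψ β) neα neβ ⟩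
  rule-ii (ψ α) (decompB (ψ β))          ≡⟨ cong (rule-ii (ψ α) ∘ decompB) ψβ≡ ⟩
  rule-ii (ψ α) (decompB (γ ⊖ (δ ⊕ one))) ≡⟨ cong (rule-ii (ψ α)) (decompB-end γ δ) ⟩
  ((ψ α ⊖ (δ ⊕ one)) ⊕ one) ⊖ γ          ≡⟨ join-sums (ψ α ⊖ (δ ⊕ one)) γ ⟩
  join (ψ α ⊖ (δ ⊕ one)) γ               ∎
  where open ≡-Reasoning

nonempty-by-length : ∀ {p q : List ℕ} → length p ≡ length q → p ≢ [] → q ≢ []
nonempty-by-length {[]} _ ne = ⊥-elim (ne refl)
nonempty-by-length {_ ∷ _} {[]} () _
nonempty-by-length {_ ∷ _} {_ ∷ _} _ _ ()

ψ-Av132 : ∀ {p} → Av132 p → Av132 (ψ p) × length (ψ p) ≡ length p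
ψ-Av132 empty = empty , refl
ψ-Av132 (node {β = β} empty cβ) rewrite ψ-case-i cβ =
  let (cψβ , len) = ψ-Av132 cβ in node empty cψβ , cong suc len
ψ-Av132 (node {α} cα@(node {α₁} {α₂} _ _) empty)
  with ψ-Av132 cα
... | cψα , lenα with Av132-join cψα (nonempty-by-length (sym lenα) (join≢[] α₁ α₂))
... | γ , δ , cγ , cδ , ψα≡ rewrite ψ-case-iii cα (join≢[] α₁ α₂) cγ ψα≡ =
  node (Av132-⊕one cγ) cδ , (begin
    length (join (γ ⊕ one) δ)         ≡⟨ length-join (γ ⊕ one) δ ⟩
    suc (length (γ ⊕ one) + length δ) ≡⟨ cong (λ m → suc (m + length δ)) (length-⊕one γ) ⟩
    suc (suc (length γ + length δ))   ≡⟨ cong suc (sym (length-join γ δ)) ⟩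
    suc (length (join γ δ))           ≡⟨ cong suc (trans (cong length (sym ψα≡)) lenα) ⟩
    suc (length α)                    ≡⟨ cong suc (sym (+-identityʳ (length α))) ⟩
    suc (length α + 0)                ≡⟨ sym (length-join α []) ⟩
    length (join α [])                ∎)
  where open ≡-Reasoning
ψ-Av132 (node {α} {β} cα@(node {α₁} {α₂} _ _) cβ@(node {β₁} {β₂} _ _))
  with ψ-Av132 cα | ψ-Av132 cβ
... | cψα , lenα | cψβ , lenβ with Av132-end cψβ (nonempty-by-length (sym lenβ) (join≢[] β₁ β₂))
... | γ , δ , cγ , cδ , ψβ≡ rewrite ψ-case-ii cα (join≢[] α₁ α₂) cβ (join≢[] β₁ β₂) ψβ≡ =
  node (Av132-⊖ cψα (Av132-⊕one cδ)) cγ , (begin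
    length (join (ψ α ⊖ (δ ⊕ one)) γ)       ≡⟨ length-join (ψ α ⊖ (δ ⊕ one)) γ ⟩
    suc (length (ψ α ⊖ (δ ⊕ one)) + length γ) ≡⟨ cong (λ m → suc (m + length γ)) (length-⊖ (ψ α) (δ ⊕ one)) ⟩
    suc (length (ψ α) + s + length γ)       ≡⟨ cong suc (+-assoc (length (ψ α)) s (length γ)) ⟩
    suc (length (ψ α) + (s + length γ))     ≡⟨ cong (λ m → suc (length (ψ α) + m)) (+-comm s (length γ)) ⟩
    suc (length (ψ α) + (length γ + s))     ≡⟨ cong₂ (λ a b → suc (a + b)) lenα ψβ-length ⟩
    suc (length α + length β)               ≡⟨ sym (length-join α β) ⟩
    length (join α β)                       ∎)
  where
  open ≡-Reasoning
  s = length (δ ⊕ one)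
  ψβ-length : length γ + s ≡ length β
  ψβ-length = trans (sym (length-⊖ γ (δ ⊕ one))) (trans (cong length (sym ψβ≡)) lenβ)

pos-top : ∀ {X} Y n → Av132 X → length (join X Y) ≡ n → pos n (join X Y) ≡ suc (length X)
pos-top {X} Y n cX len≡ = subst (λ m → pos m (join X Y) ≡ suc (length X))
                               (trans (sym (length-join X Y)) len≡) (pos-join Y cX)

pos-join-⊕one : ∀ {γ} δ → Av132 γ → pos (suc (length γ + length δ)) (join (γ ⊕ one) δ) ≡ suc (length γ)
pos-join-⊕one {γ} δ cγ = trans (cong (pos m) shape) (trans (pos-at m _ _ below) (cong suc (length-map _ γ)))
  where
  m = suc (length γ + length δ)
  below : All (_< m) (map (_+ length δ) γ)
  below = Av132-lifted-below (length δ) m cγ ≤-refl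
  shape : join (γ ⊕ one) δ ≡ map (_+ length δ) γ ++ m ∷ suc (length (γ ⊕ one) + length δ) ∷ δ
  shape = trans (cong (_++ rest) (map-++ (_+ length δ) γ (suc (length γ) ∷ [])))
                (++-assoc (map (_+ length δ) γ) (m ∷ []) rest)
    where rest = suc (length (γ ⊕ one) + length δ) ∷ δ

-- In join (A ⊖ B) C, the value |A|+|B|+|C| is the top of the A block,
-- hence within the first |A| positions.
pos-join-⊖ : ∀ {A} B C → Av132 A → A ≢ [] →
  pos (length A + length B + length C) (join (A ⊖ B) C) ≤ length A
pos-join-⊖ {A} B C cA ne =
  subst (λ σ → pos top σ ≤ length A) (sym shape)
    (≤-trans (pos-within top prefix _ top∈) (≤-reflexive (trans (length-map (_+ length C) (map (_+ length B) A)) (length-map (_+ length B) A))))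
  where
  top = length A + length B + length C
  prefix = map (_+ length C) (map (_+ length B) A)
  top∈ : top ∈ prefix
  top∈ = ∈-map⁺ (_+ length C) (∈-map⁺ (_+ length B) (Av132-max∈ cA ne))
  shape : join (A ⊖ B) C ≡ prefix ++ (map (_+ length C) B ++ suc (length (A ⊖ B) + length C) ∷ C)
  shape = trans (cong (_++ rest) (map-++ (_+ length C) (map (_+ length B) A) B))
                (++-assoc prefix (map (_+ length C) B) rest)
    where rest = suc (length (A ⊖ B) + length C) ∷ C

-- Each of the three situations below decides all three equivalences, since
-- the cases are mutually exclusive on either side.
Criteria : ℕ → ℕ → ℕ → ℕ → Set
Criteria n a b c = ((a ≡ 1) ⇔ (b ≡ 1))
  × (((2 ≤ a) × (a ≤ n ∸ 1)) ⇔ ((1 < b) × (1 < b ∸ c)))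
  × ((a ≡ n) ⇔ ((1 < b) × (b ∸ c ≡ 1)))

n≰n∸1 : ∀ {n} → 1 ≤ n → ¬ (n ≤ n ∸ 1)
n≰n∸1 {suc m} _ = <-irrefl refl

criteria-first : ∀ {n a b c} → 2 ≤ n → a ≡ 1 → b ≡ 1 → Criteria n a b c
criteria-first 2≤n refl refl =
  mk⇔ (λ _ → refl) (λ _ → refl) ,
  mk⇔ (λ { (s≤s () , _) }) (λ { (s≤s () , _) }) ,
  mk⇔ (λ 1≡n → ⊥-elim (<-irrefl 1≡n 2≤n)) (λ { (s≤s () , _) })

criteria-middle : ∀ {n a b c} → 2 ≤ a → a ≤ n ∸ 1 → 1 < b → 1 < b ∸ c → Criteria n a b c
criteria-middle 2≤a a≤n-1 1<b 1<b-c =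
  mk⇔ (λ a≡1 → ⊥-elim (<-irrefl (sym a≡1) 2≤a)) (λ b≡1 → ⊥-elim (<-irrefl (sym b≡1) 1<b)) ,
  mk⇔ (λ _ → 1<b , 1<b-c) (λ _ → 2≤a , a≤n-1) ,
  mk⇔ (λ { refl → ⊥-elim (n≰n∸1 (≤-trans (s≤s z≤n) 2≤a) a≤n-1) })
      (λ { (_ , b-c≡1) → ⊥-elim (<-irrefl (sym b-c≡1) 1<b-c) })

criteria-last : ∀ {n a b c} → 2 ≤ n → a ≡ n → 1 < b → b ∸ c ≡ 1 → Criteria n a b c
criteria-last 2≤n refl 1<b b-c≡1 =
  mk⇔ (λ n≡1 → ⊥-elim (<-irrefl (sym n≡1) 2≤n)) (λ b≡1 → ⊥-elim (<-irrefl (sym b≡1) 1<b)) ,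
  mk⇔ (λ { (_ , n≤n-1) → ⊥-elim (n≰n∸1 (≤-trans (s≤s z≤n) 2≤n) n≤n-1) })
      (λ { (_ , 1<b-c) → ⊥-elim (<-irrefl (sym b-c≡1) 1<b-c) }) ,
  mk⇔ (λ _ → 1<b , b-c≡1) (λ _ → refl)

PositionCriteria : List ℕ → Set
PositionCriteria π = Criteria n (pos n π) (pos n (ψ π)) (pos (n ∸ 1) (ψ π))
  where n = length π

positions-i : ∀ {β} → Av132 β → 2 ≤ length (join [] β) → PositionCriteria (join [] β)
positions-i {β} cβ 2≤n rewrite ψ-case-i cβ =
  criteria-first {c = pos (length β) (join [] (ψ β))} 2≤n (pos-join β empty) (pos-top (ψ β) _ empty (cong suc (proj₂ (ψ-Av132 cβ))))

-- Rule (iii): π = α ⊕ 1; then σ = ((γ ⊕ 1) ⊕ 1) ⊖ δ ends its top block with n-1, n.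
positions-iii : ∀ {α} → Av132 α → α ≢ [] → PositionCriteria (join α [])
positions-iii {α} cα ne with ψ-Av132 cα
... | cψα , lenα with Av132-join cψα (nonempty-by-length (sym lenα) ne)
... | γ , δ , cγ , cδ , ψα≡ rewrite ψ-case-iii cα ne cγ ψα≡ =
  criteria-last {c = pos (n ∸ 1) (join (γ ⊕ one) δ)} (subst (2 ≤_) (sym n≡) (s≤s (s≤s z≤n)))
                (trans (pos-top [] n cα refl) (sym (trans (length-join α []) (cong suc (+-identityʳ _)))))
                (subst (1 <_) (sym b≡) (s≤s (s≤s z≤n)))
                (trans (cong₂ _∸_ b≡ c≡) (m+n∸n≡m 1 (suc (length γ))))
  where
  n = length (join α [])
  n≡ : n ≡ suc (suc (length γ + length δ))
  n≡ = begin
    length (join α [])        ≡⟨ length-join α [] ⟩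
    suc (length α + 0)        ≡⟨ cong suc (+-identityʳ (length α)) ⟩
    suc (length α)            ≡⟨ cong suc (trans (sym lenα) (cong length ψα≡)) ⟩
    suc (length (join γ δ))   ≡⟨ cong suc (length-join γ δ) ⟩
    suc (suc (length γ + length δ)) ∎
    where open ≡-Reasoning
  b≡ : pos n (join (γ ⊕ one) δ) ≡ suc (suc (length γ))
  b≡ = trans (pos-top δ n (Av132-⊕one cγ) (trans (cong length (sym ψα≡′)) (proj₂ (ψ-Av132 (node cα empty)))))
             (cong suc (length-⊕one γ))
    where
    ψα≡′ : ψ (join α []) ≡ join (γ ⊕ one) δ
    ψα≡′ = ψ-case-iii cα ne cγ ψα≡
  c≡ : pos (n ∸ 1) (join (γ ⊕ one) δ) ≡ suc (length γ)
  c≡ = trans (cong (λ m → pos (m ∸ 1) (join (γ ⊕ one) δ)) n≡) (pos-join-⊕one δ cγ)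

-- Rule (ii): π = (α ⊕ 1) ⊖ β with α, β nonempty; in σ the value n-1 lies in
-- the ψ(α) block, at least |δ ⊕ 1| + 1 ≥ 2 places before n.
positions-ii : ∀ {α β} → Av132 α → α ≢ [] → Av132 β → β ≢ [] → PositionCriteria (join α β)
positions-ii {α} {β} cα neα cβ neβ with ψ-Av132 cα | ψ-Av132 cβ
... | cψα , lenα | cψβ , lenβ with Av132-end cψβ (nonempty-by-length (sym lenβ) neβ)
... | γ , δ , cγ , cδ , ψβ≡ rewrite ψ-case-ii cα neα cβ neβ ψβ≡ =
  criteria-middle {c = pos (n ∸ 1) (join X γ)}
    (subst (2 ≤_) (sym a≡) (s≤s (length≥1 neα)))
    (subst (_≤ n ∸ 1) (sym a≡) a≤)
    (subst (1 <_) (sym b≡) (s≤s (≤-trans (length≥1 (nonempty-by-length {q = ψ α} (sym lenα) neα)) (m≤m+n (length (ψ α)) s))))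
    (≤-trans (s≤s s≥1) (≤-trans (≤-reflexive (sym b-|ψα|)) (∸-monoʳ-≤ b c≤)))
  where
  open ≡-Reasoning
  length≥1 : ∀ {xs : List ℕ} → xs ≢ [] → 1 ≤ length xs
  length≥1 {[]} ne = ⊥-elim (ne refl)
  length≥1 {_ ∷ _} _ = s≤s z≤n
  n = length (join α β)
  X = ψ α ⊖ (δ ⊕ one)
  s = length (δ ⊕ one)
  s≥1 : 1 ≤ s
  s≥1 = subst (1 ≤_) (sym (length-⊕one δ)) (s≤s z≤n)
  σ≡ : ψ (join α β) ≡ join X γ
  σ≡ = ψ-case-ii cα neα cβ neβ ψβ≡
  n≡ : length (join X γ) ≡ n
  n≡ = trans (cong length (sym σ≡)) (proj₂ (ψ-Av132 (node cα cβ)))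
  a≡ : pos n (join α β) ≡ suc (length α)
  a≡ = pos-top β n cα refl
  a≤ : suc (length α) ≤ n ∸ 1
  a≤ = subst (suc (length α) ≤_) (cong (_∸ 1) (sym (length-join α β)))
             (subst (_≤ length α + length β) (+-comm (length α) 1)
                    (+-monoʳ-≤ (length α) (length≥1 neβ)))
  b = pos n (join X γ)
  b≡ : b ≡ suc (length (ψ α) + s)
  b≡ = trans (pos-top γ n (Av132-⊖ cψα (Av132-⊕one cδ)) n≡) (cong suc (length-⊖ (ψ α) (δ ⊕ one)))
  c≤ : pos (n ∸ 1) (join X γ) ≤ length (ψ α)
  c≤ = subst (λ m → pos m (join X γ) ≤ length (ψ α)) n-1≡
             (pos-join-⊖ (δ ⊕ one) γ cψα (nonempty-by-length (sym lenα) neα))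
    where
    n-1≡ : length (ψ α) + s + length γ ≡ n ∸ 1
    n-1≡ = begin
      length (ψ α) + s + length γ   ≡⟨ cong (_+ length γ) (sym (length-⊖ (ψ α) (δ ⊕ one))) ⟩
      length X + length γ           ≡⟨ cong (_∸ 1) (sym (length-join X γ)) ⟩
      length (join X γ) ∸ 1         ≡⟨ cong (_∸ 1) n≡ ⟩
      n ∸ 1                         ∎
  b-|ψα| : b ∸ length (ψ α) ≡ suc s
  b-|ψα| = trans (cong (_∸ length (ψ α)) (trans b≡ (sym (+-suc (length (ψ α)) s))))
                 (m+n∸m≡n (length (ψ α)) (suc s))

range : ℕ → List ℕ
range n = map suc (upTo n)

range-suc : ∀ n → range (suc n) ≡ range n ∷ʳ suc n
range-suc n = trans (cong (map suc) (sym (upTo-∷ʳ n))) (map-++ suc (upTo n) (n ∷ []))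

length-↭range : ∀ {xs} m → xs ↭ range m → length xs ≡ m
length-↭range m xs↭ = trans (↭-length xs↭) (trans (length-map suc (upTo m)) (length-upTo m))

∈-range⇒≤ : ∀ n {x} → x ∈ range n → x ≤ n
∈-range⇒≤ zero ()
∈-range⇒≤ (suc n) {x} x∈ with ∈-++⁻ (range n) (subst (x ∈_) (range-suc n) x∈)
... | inj₁ x∈′ = m≤n⇒m≤1+n (∈-range⇒≤ n x∈′)
... | inj₂ (here refl) = ≤-refl

top∈range : ∀ n → suc n ∈ range (suc n)
top∈range n = subst (suc n ∈_) (sym (range-suc n)) (∈-++⁺ʳ (range n) (here refl))

drop-top : ∀ L R m → L ++ suc m ∷ R ↭ range (suc m) → L ++ R ↭ range m
drop-top L R m perm = ↭-trans (drop-mid L (range m) (↭-trans perm (↭-reflexive (range-suc m))))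
                              (↭-reflexive (++-identityʳ (range m)))

Avoids132′ : List ℕ → Set
Avoids132′ p = ∀ a x b y c z d → p ≡ a ++ x ∷ b ++ y ∷ c ++ z ∷ d → ¬ (x < z × z < y)

index-of : ∀ (p a : List ℕ) (x : ℕ) (r : List ℕ) → p ≡ a ++ x ∷ r → Σ[ i ∈ Fin (length p) ] lookup p i ≡ x × toℕ i ≡ length a
index-of .(x ∷ r) [] x r refl = fzero , refl , refl
index-of .(a₀ ∷ a ++ x ∷ r) (a₀ ∷ a) x r refl =
  let (i , at , i≡) = index-of (a ++ x ∷ r) a x r refl in fsuc i , at , cong suc i≡

length-< : ∀ (a : List ℕ) x b → length a < length (a ++ x ∷ b)
length-< a x b = subst (length a <_) (sym (length-++ a)) (m<m+n (length a) (s≤s z≤n))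

avoids⇒avoids′ : ∀ p → Avoids132 p → Avoids132′ p
avoids⇒avoids′ p av a x b y c z d p≡ (x<z , z<y) with index-of p a x _ p≡
  | index-of p (a ++ x ∷ b) y _ (trans p≡ (sym (++-assoc a (x ∷ b) _)))
  | index-of p ((a ++ x ∷ b) ++ y ∷ c) z d
      (trans p≡ (sym (trans (++-assoc (a ++ x ∷ b) (y ∷ c) (z ∷ d)) (++-assoc a (x ∷ b) (y ∷ c ++ z ∷ d)))))
... | i , at-i , i≡ | j , at-j , j≡ | k , at-k , k≡ =
  av i j k (subst₂ _<_ (sym i≡) (sym j≡) (length-< a x b))
           (subst₂ _<_ (sym j≡) (sym k≡) (length-< (a ++ x ∷ b) y c))
           (subst₂ _<_ (sym at-i) (sym at-k) x<z , subst₂ _<_ (sym at-k) (sym at-j) z<y)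

avoids′-++ʳ : ∀ xs ys → Avoids132′ (xs ++ ys) → Avoids132′ ys
avoids′-++ʳ xs ys av a x b y c z d ys≡ =
  av (xs ++ a) x b y c z d (trans (cong (xs ++_) ys≡) (sym (++-assoc xs a _)))

avoids′-++ˡ : ∀ xs ys → Avoids132′ (xs ++ ys) → Avoids132′ xs
avoids′-++ˡ xs ys av a x b y c z d xs≡ = av a x b y c z (d ++ ys) (begin
  xs ++ ys                                          ≡⟨ cong (_++ ys) xs≡ ⟩
  (a ++ x ∷ b ++ y ∷ c ++ z ∷ d) ++ ys              ≡⟨ ++-assoc a _ ys ⟩
  a ++ x ∷ (b ++ y ∷ c ++ z ∷ d) ++ ys              ≡⟨ cong (λ t → a ++ x ∷ t) (++-assoc b _ ys) ⟩
  a ++ x ∷ b ++ y ∷ (c ++ z ∷ d) ++ ys              ≡⟨ cong (λ t → a ++ x ∷ b ++ y ∷ t) (++-assoc c _ ys) ⟩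
  a ++ x ∷ b ++ y ∷ c ++ z ∷ d ++ ys                ∎)
  where open ≡-Reasoning

map-split : ∀ (f : ℕ → ℕ) L a x r → map f L ≡ a ++ x ∷ r →
  ∃[ a′ ] ∃[ x′ ] ∃[ r′ ] L ≡ a′ ++ x′ ∷ r′ × f x′ ≡ x × map f r′ ≡ r
map-split f [] [] x r ()
map-split f [] (_ ∷ _) x r ()
map-split f (l ∷ L) [] x r eq = [] , l , L , refl , proj₁ (∷-injective eq) , proj₂ (∷-injective eq)
map-split f (l ∷ L) (_ ∷ a) x r eq with map-split f L a x r (proj₂ (∷-injective eq))
... | a′ , x′ , r′ , L≡ , fx′ , r≡ = l ∷ a′ , x′ , r′ , cong (l ∷_) L≡ , fx′ , r≡

avoids′-map : ∀ (f : ℕ → ℕ) L → (∀ {u v} → f u < f v → u < v) → Avoids132′ L → Avoids132′ (map f L)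
avoids′-map f L reflects av a x b y c z d eq
  with map-split f L a x _ eq
... | a₁ , x₁ , r₁ , L≡ , fx , r₁≡ with map-split f r₁ b y _ r₁≡
... | b₁ , y₁ , r₂ , r₁≡′ , fy , r₂≡ with map-split f r₂ c z d r₂≡
... | c₁ , z₁ , d₁ , r₂≡′ , fz , _ = λ { (x<z , z<y) →
  av a₁ x₁ b₁ y₁ c₁ z₁ d₁ (trans L≡ (cong (λ t → a₁ ++ x₁ ∷ t) (trans r₁≡′ (cong (λ t → b₁ ++ y₁ ∷ t) r₂≡′))))
     (reflects (subst₂ _<_ (sym fx) (sym fz) x<z) , reflects (subst₂ _<_ (sym fz) (sym fy) z<y)) }

∸-reflects-< : ∀ c {u v} → u ∸ c < v ∸ c → u < v
∸-reflects-< c {u} {v} lt with u <? v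
... | yes u<v = u<v
... | no u≮v = ⊥-elim (<⇒≱ lt (∸-monoˡ-≤ c (≮⇒≥ u≮v)))

_Above_ : List ℕ → List ℕ → Set
L Above R = ∀ {l r} → l ∈ L → r ∈ R → r ≤ l

top∈left : ∀ m l L R → (l ∷ L) ++ R ↭ range (suc m) → (l ∷ L) Above R → suc m ∈ l ∷ L
top∈left m l L R perm above with ∈-++⁻ (l ∷ L) (∈-resp-↭ (↭-sym perm) (top∈range m))
... | inj₁ top∈L = top∈L
... | inj₂ top∈R = here (≤-antisym (above (here refl) top∈R) (∈-range⇒≤ (suc m) (∈-resp-↭ perm (here refl))))

blocks : ∀ m L R → L ++ R ↭ range m → L Above R →
  R ↭ range (length R) × L ↭ map (_+ length R) (range (length L))
blocks m [] R perm _ = subst (λ k → R ↭ range k) (sym (length-↭range m perm)) perm , ↭-refl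
blocks zero (l ∷ L) R perm _ with ↭-length perm
... | ()
blocks (suc m) (l ∷ L) R perm above with ∈-∃++ (top∈left m l L R perm above)
... | L₁ , L₂ , L≡ = proj₁ IH , L↭
  where
  top = suc m
  L₁₂ = L₁ ++ L₂
  perm′ : L₁₂ ++ R ↭ range m
  perm′ = subst (_↭ range m) (sym (++-assoc L₁ L₂ R))
            (drop-top L₁ (L₂ ++ R) m (subst (_↭ range top) (trans (cong (_++ R) L≡) (++-assoc L₁ (top ∷ L₂) R)) perm))
  ⊆L : ∀ {v} → v ∈ L₁₂ → v ∈ l ∷ L
  ⊆L v∈ with ∈-++⁻ L₁ v∈
  ... | inj₁ v∈L₁ = subst (_ ∈_) (sym L≡) (∈-++⁺ˡ v∈L₁)
  ... | inj₂ v∈L₂ = subst (_ ∈_) (sym L≡) (∈-++⁺ʳ L₁ (there v∈L₂))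
  IH = blocks m L₁₂ R perm′ (λ v∈ r∈ → above (⊆L v∈) r∈)
  length-L : length (l ∷ L) ≡ suc (length L₁₂)
  length-L = trans (cong length L≡) (trans (length-++ L₁) (trans (+-suc _ _) (cong suc (sym (length-++ L₁)))))
  top≡ : top ≡ suc (length L₁₂) + length R
  top≡ = cong suc (trans (sym (length-↭range m perm′)) (length-++ L₁₂))
  L↭ : l ∷ L ↭ map (_+ length R) (range (length (l ∷ L)))
  L↭ = begin
    l ∷ L                                       ≡⟨ L≡ ⟩
    L₁ ++ top ∷ L₂                              ↭⟨ shift top L₁ L₂ ⟩
    top ∷ L₁₂                                   ↭⟨ ∷↭∷ʳ top L₁₂ ⟩
    L₁₂ ∷ʳ top                                  ↭⟨ ++⁺ʳ (top ∷ []) (proj₂ IH) ⟩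
    map (_+ length R) (range (length L₁₂)) ∷ʳ top ≡⟨ cong (map (_+ length R) (range (length L₁₂)) ∷ʳ_) top≡ ⟩
    map (_+ length R) (range (length L₁₂)) ∷ʳ (suc (length L₁₂) + length R)
                                                ≡⟨ sym (map-++ (_+ length R) (range (length L₁₂)) _) ⟩
    map (_+ length R) (range (length L₁₂) ∷ʳ suc (length L₁₂))
                                                ≡⟨ cong (map (_+ length R)) (sym (range-suc (length L₁₂))) ⟩
    map (_+ length R) (range (suc (length L₁₂))) ≡⟨ cong (map (_+ length R) ∘ range) (sym length-L) ⟩
    map (_+ length R) (range (length (l ∷ L)))  ∎
    where open PermutationReasoning

-- In a 132-avoider, everything left of the maximum lies above everything
-- right of it: l < r would make l, max, r an occurrence of 132.
split-at-top : ∀ m p → p ↭ range (suc m) → Avoids132′ p →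
  ∃[ L ] ∃[ R ] p ≡ L ++ suc m ∷ R × L ++ R ↭ range m × L Above R
split-at-top m p perm av with ∈-∃++ (∈-resp-↭ (↭-sym perm) (top∈range m))
... | L , R , p≡ = L , R , p≡ , perm′ , above
  where
  perm′ : L ++ R ↭ range m
  perm′ = drop-top L R m (subst (_↭ range (suc m)) p≡ perm)
  above : L Above R
  above {l} {r} l∈L r∈R with ∈-∃++ l∈L | ∈-∃++ r∈R | l <? r
  ... | _ , _ , _ | _ , _ , _ | no l≮r = ≮⇒≥ l≮r
  ... | L₁ , L₂ , L≡ | R₁ , R₂ , R≡ | yes l<r = ⊥-elim (av L₁ l L₂ (suc m) R₁ r R₂ p≡′ (l<r , r<top))
    where
    p≡′ : p ≡ L₁ ++ l ∷ L₂ ++ suc m ∷ R₁ ++ r ∷ R₂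
    p≡′ = trans p≡ (trans (cong₂ (λ A B → A ++ suc m ∷ B) L≡ R≡) (++-assoc L₁ (l ∷ L₂) _))
    r<top : r < suc m
    r<top = s≤s (∈-range⇒≤ m (∈-resp-↭ perm′ (∈-++⁺ʳ L r∈R)))

lower-block : ∀ c L → L ↭ map (_+ c) (range (length L)) → map (_∸ c) L ↭ range (length (map (_∸ c) L))
lower-block c L L↭ = ↭-trans (↭-map⁺ (_∸ c) L↭)
  (↭-reflexive (trans (map-+-∸ c (range (length L))) (cong range (sym (length-map (_∸ c) L)))))

lift-lower : ∀ c L {xs} → L ↭ map (_+ c) xs → map (_+ c) (map (_∸ c) L) ≡ L
lift-lower c L L↭ = trans (sym (map-∘ L)) (map-id-local (All.tabulate restore))
  where
  restore : ∀ {y} → y ∈ L → y ∸ c + c ≡ y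
  restore y∈ with ∈-map⁻ (_+ c) (∈-resp-↭ L↭ y∈)
  ... | z , _ , refl = m∸n+n≡m (m≤n+m c z)

-- Completeness, by well-founded induction on the length: split at the
-- maximum, standardize the left part, and recurse on both parts.
Av132-complete : ∀ p → Acc _<_ (length p) → p ↭ range (length p) → Avoids132′ p → Av132 p
Av132-complete [] _ _ _ = empty
Av132-complete (x ∷ xs) (acc rec) perm av with split-at-top (length xs) (x ∷ xs) perm av
... | L , R , p≡ , perm′ , above = subst Av132 join≡ (node cα cR)
  where
  m = length xs
  α = map (_∸ length R) L
  blocks-LR = blocks m L R perm′ above
  av′ : Avoids132′ (L ++ suc m ∷ R)
  av′ = subst Avoids132′ p≡ av
  L+R≡m : length α + length R ≡ m
  L+R≡m = trans (cong (_+ length R) (length-map _ L)) (trans (sym (length-++ L)) (length-↭range m perm′))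
  α<p : length α < suc m
  α<p = s≤s (subst (length α ≤_) L+R≡m (m≤m+n _ _))
  R<p : length R < suc m
  R<p = s≤s (subst (length R ≤_) L+R≡m (m≤n+m _ _))
  cα : Av132 α
  cα = Av132-complete α (rec α<p) (lower-block (length R) L (proj₂ blocks-LR))
         (avoids′-map (_∸ length R) L (∸-reflects-< (length R)) (avoids′-++ˡ L (suc m ∷ R) av′))
  cR : Av132 R
  cR = Av132-complete R (rec R<p) (proj₁ blocks-LR)
         (avoids′-++ʳ (suc m ∷ []) R (avoids′-++ʳ L (suc m ∷ R) av′))
  join≡ : join α R ≡ x ∷ xs
  join≡ = trans (cong₂ (λ A k → A ++ suc k ∷ R) (lift-lower (length R) L (proj₂ blocks-LR)) L+R≡m) (sym p≡)

positions : ∀ {π} → Av132 π → 2 ≤ length π → PositionCriteria π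
positions empty ()
positions (node empty cβ) 2≤n = positions-i cβ 2≤n
positions (node cα@(node {α₁} {α₂} _ _) empty) _ = positions-iii cα (join≢[] α₁ α₂)
positions (node cα@(node {α₁} {α₂} _ _) cβ@(node {β₁} {β₂} _ _)) _ =
  positions-ii cα (join≢[] α₁ α₂) cβ (join≢[] β₁ β₂)

proposition2 : (n : ℕ) → 2 ≤ n → (π : List ℕ) → IsPerm n π → Avoids132 π →
    ((pos n π ≡ 1) ⇔ (pos n (ψ π) ≡ 1))
    × (((2 ≤ pos n π) × (pos n π ≤ n ∸ 1))
        ⇔ ((1 < pos n (ψ π)) × (1 < pos n (ψ π) ∸ pos (n ∸ 1) (ψ π))))
    × ((pos n π ≡ n)
        ⇔ ((1 < pos n (ψ π)) × (pos n (ψ π) ∸ pos (n ∸ 1) (ψ π) ≡ 1)))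
proposition2 n 2≤n π perm av =
  subst (λ k → Criteria k (pos k π) (pos k (ψ π)) (pos (k ∸ 1) (ψ π))) len≡ (positions cπ (subst (2 ≤_) (sym len≡) 2≤n))
  where
  len≡ : length π ≡ n
  len≡ = length-↭range n perm
  cπ : Av132 π
  cπ = Av132-complete π (<-wellFounded (length π)) (subst (λ k → π ↭ range k) (sym len≡) perm) (avoids⇒avoids′ π av)
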